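{- Fix an integer $k\ge1$. The category $\mathbf{FR}_k^0$ has pushouts.
   Context: An additive set $(A,Z)$ is a pair where $Z$ is an abelian group and $A$ is a finite non-empty subset of $Z$. For additive sets $(A,Z)$, $(B,W)$ and an integer $k\ge1$, a Freiman homomorphism of order $k$ $\phi:(A,Z)\to(B,W)$ is a map $\phi:A\to B$ such that for all $a_1,\dots,a_k,a'_1,\dots,a'_k\in A$, $a_1+\cdots+a_k=a'_1+\cdots+a'_k$ implies $\phi(a_1)+\cdots+\phi(a_k)=\phi(a'_1)+\cdots+\phi(a'_k)$. An additive set $(A,Z)$ is normalized if $0_Z\in A$. The normalized Freiman category $\mathbf{FR}_k^0$ has normalized additive sets as objects and, as morphisms, Freiman homomorphisms of order $k$ that send $0$ to $0$, with composition being composition of maps. -}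

module Defs where

open import Level using (Level; suc)
open import Algebra.Bundles using (AbelianGroup)
open import Data.List using (List)
open import Data.Nat using (ℕ)
open import Data.Vec using (Vec; []; _∷_; map)
open import Data.Product using (Σ; _,_; proj₁; proj₂; _×_; ∃)
import Data.List.Membership.Setoid as SetoidMembership

-- An additive set (A , Z): an abelian group Z together with a finite subset A of Z,
-- given by a list enumerating its elements (membership is up to the group's equality).
record NAddSet (ℓ : Level) : Set (suc ℓ) where
  field
    grp  : AbelianGroup ℓ ℓ
  open AbelianGroup grp public
  open SetoidMembership setoid public using (_∈_)
  field
    elems : List Carrier
    zero∈ : ε ∈ elems

  El : Set ℓ
  El = Σ Carrier (λ z → z ∈ elems)

  zeroEl : El
  zeroEl = ε , zero∈

  sumV : ∀ {k} → Vec El k → Carrier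
  sumV []       = ε
  sumV (x ∷ xs) = proj₁ x ∙ sumV xs

open NAddSet

record Hom {ℓ : Level} (k : ℕ) (A B : NAddSet ℓ) : Set ℓ where
  field
    fun      : El A → El B
    resp     : ∀ {a a'} → _≈_ A (proj₁ a) (proj₁ a') → _≈_ B (proj₁ (fun a)) (proj₁ (fun a'))
    pres0    : _≈_ B (proj₁ (fun (zeroEl A))) (ε B)
    freiman  : (as bs : Vec (El A) k) → _≈_ A (sumV A as) (sumV A bs)
               → _≈_ B (sumV B (map fun as)) (sumV B (map fun bs))
open Hom public

_∘H_ : ∀ {ℓ k} {A B C : NAddSet ℓ} → Hom k B C → Hom k A B → Hom k A C
_∘H_ {A = A} {B} {C} g f = record
  { fun = λ a → fun g (fun f a)
  ; resp = λ e → resp g (resp f e)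
  ; pres0 = trans C (resp g (pres0 f)) (pres0 g)
  ; freiman = λ as bs e → subst2 as bs (freiman g (Data.Vec.map (fun f) as) (Data.Vec.map (fun f) bs) (freiman f as bs e))
  }
  where
  open import Data.Vec.Properties using (map-∘)
  open import Relation.Binary.PropositionalEquality using (_≡_; subst₂) renaming (sym to ≡-sym)
  subst2 : ∀ as bs → _≈_ C (sumV C (map (fun g) (map (fun f) as))) (sumV C (map (fun g) (map (fun f) bs)))
           → _≈_ C (sumV C (map (λ a → fun g (fun f a)) as)) (sumV C (map (λ a → fun g (fun f a)) bs))
  subst2 as bs e = subst₂ (λ u v → _≈_ C (sumV C u) (sumV C v))
                     (≡-sym (map-∘ (fun g) (fun f) as)) (≡-sym (map-∘ (fun g) (fun f) bs)) e

_≈H_ : ∀ {ℓ k} {A B : NAddSet ℓ} → Hom k A B → Hom k A B → Set ℓ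
_≈H_ {A = A} {B} f g = ∀ (a : El A) → _≈_ B (proj₁ (fun f a)) (proj₁ (fun g a))

record IsPushout {ℓ k} {C A B P : NAddSet ℓ} (f : Hom k C A) (g : Hom k C B)
                 (i : Hom k A P) (j : Hom k B P) : Set (suc ℓ) where
  field
    commutes  : (i ∘H f) ≈H (j ∘H g)
    universal : ∀ (Q : NAddSet ℓ) (i' : Hom k A Q) (j' : Hom k B Q)
                → (i' ∘H f) ≈H (j' ∘H g)
                → Σ (Hom k P Q) (λ h → ((h ∘H i) ≈H i') × ((h ∘H j) ≈H j')
                     × (∀ (h' : Hom k P Q) → (h' ∘H i) ≈H i' → (h' ∘H j) ≈H j' → h' ≈H h))

HasPushouts : (ℓ : Level) → ℕ → Set (suc ℓ)
HasPushouts ℓ k = ∀ {C A B : NAddSet ℓ} (f : Hom k C A) (g : Hom k C B)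
  → Σ (NAddSet ℓ) (λ P → Σ (Hom k A P) (λ i → Σ (Hom k B P) (λ j → IsPushout f g i j)))

-- The pushout of f : C → A and g : C → B is the additive set i(A) ∪ j(B) inside the abelian
-- group U presented by generators A ⊔ B and the relations that an order-k Freiman cocone out of
-- (A , B) must satisfy: equal elements are identified, both zeros are 0, f c = g c, and every
-- order-k additive relation of A or of B holds. A cocone (i′ , j′) into Q is then exactly a
-- generator assignment respecting these relations, so it extends to a homomorphism U → Q, and
-- restricting that homomorphism to i(A) ∪ j(B) is the mediating Freiman homomorphism. Uniqueness
-- holds because every element of the pushout is a generator.
module Submission where

open import Defs
open import Level using (Level; _⊔_)
open import Data.Nat using (ℕ; _≥_)
open import Data.Vec using (Vec; []; _∷_; map)
open import Data.List using (List; _++_) renaming (map to mapᴸ)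
open import Data.List.Relation.Unary.Any as Any using (Any; here; there; satisfied)
open import Data.List.Relation.Unary.Any.Properties using (map⁺; map⁻; ++⁺ˡ; ++⁺ʳ)
import Data.List.Membership.Setoid as SetoidMembership
open import Algebra.Bundles using (AbelianGroup)
open import Relation.Binary.Bundles using (Setoid)
open import Relation.Binary.Core using (Rel)
open import Data.Sum using (_⊎_; inj₁; inj₂; [_,_])
open import Data.Product using (Σ; _,_; proj₁; proj₂)
open import Function using (_∘_)
import Relation.Binary.PropositionalEquality as ≡

module _ {c e} (S : Setoid c e) where
  open Setoid S
  open SetoidMembership S using (_∈_; mapWith∈)

  ∈⇒Any-mapWith∈-pair : ∀ {q} {Q : Carrier → Set q} {xs} (g : ∀ {x} → x ∈ xs → Q x) {z}
                      → z ∈ xs → Any (λ y → z ≈ proj₁ y) (mapWith∈ xs (λ {x} p → x , g p))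
  ∈⇒Any-mapWith∈-pair g (here z≈x) = here z≈x
  ∈⇒Any-mapWith∈-pair g (there p)  = there (∈⇒Any-mapWith∈-pair (g ∘ there) p)

module _ {ℓ} (D : NAddSet ℓ) where
  open NAddSet D
  open SetoidMembership setoid using (mapWith∈)

  elemsEl : List El
  elemsEl = mapWith∈ elems (λ {x} p → x , p)

  El∈elemsEl : (a : El) → Any (λ b → proj₁ a ≈ proj₁ b) elemsEl
  El∈elemsEl (a , a∈) = ∈⇒Any-mapWith∈-pair setoid (λ p → p) a∈

infixl 7 _∙_
infix  8 _⁻¹

data Term {x} (X : Set x) : Set x where
  var  : X → Term X
  ε    : Term X
  _∙_  : Term X → Term X → Term X
  _⁻¹  : Term X → Term X

sumVars : ∀ {x n} {X : Set x} → Vec X n → Term X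
sumVars []       = ε
sumVars (x ∷ xs) = var x ∙ sumVars xs

module Presentation {x r} {X : Set x} (R : Rel (Term X) r) where

  infix 4 _~_
  data _~_ : Rel (Term X) (x ⊔ r) where
    rel        : ∀ {s t} → R s t → s ~ t
    refl       : ∀ {s} → s ~ s
    sym        : ∀ {s t} → s ~ t → t ~ s
    trans      : ∀ {s t u} → s ~ t → t ~ u → s ~ u
    ∙-cong     : ∀ {s s′ t t′} → s ~ s′ → t ~ t′ → s ∙ t ~ s′ ∙ t′
    ⁻¹-cong    : ∀ {s s′} → s ~ s′ → s ⁻¹ ~ s′ ⁻¹
    assoc      : ∀ {s t u} → (s ∙ t) ∙ u ~ s ∙ (t ∙ u)
    identityˡ  : ∀ {s} → ε ∙ s ~ s
    identityʳ  : ∀ {s} → s ∙ ε ~ s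
    inverseˡ   : ∀ {s} → s ⁻¹ ∙ s ~ ε
    inverseʳ   : ∀ {s} → s ∙ s ⁻¹ ~ ε
    comm       : ∀ {s t} → s ∙ t ~ t ∙ s

  presented : AbelianGroup x (x ⊔ r)
  presented = record
    { Carrier = Term X ; _≈_ = _~_ ; _∙_ = _∙_ ; ε = ε ; _⁻¹ = _⁻¹
    ; isAbelianGroup = record
      { isGroup = record
        { isMonoid = record
          { isSemigroup = record
            { isMagma = record
              { isEquivalence = record { refl = refl ; sym = sym ; trans = trans }
              ; ∙-cong = ∙-cong }
            ; assoc = λ _ _ _ → assoc }
          ; identity = (λ _ → identityˡ) , (λ _ → identityʳ) }
        ; inverse = (λ _ → inverseˡ) , (λ _ → inverseʳ)
        ; ⁻¹-cong = ⁻¹-cong }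
      ; comm = λ _ _ → comm } }

  module Eval {c e} (G : AbelianGroup c e) (ρ : X → AbelianGroup.Carrier G) where
    private module G = AbelianGroup G

    ⟦_⟧ : Term X → G.Carrier
    ⟦ var s ⟧  = ρ s
    ⟦ ε ⟧      = G.ε
    ⟦ s ∙ t ⟧  = ⟦ s ⟧ G.∙ ⟦ t ⟧
    ⟦ s ⁻¹ ⟧   = ⟦ s ⟧ G.⁻¹

    ⟦⟧-cong : (∀ {s t} → R s t → ⟦ s ⟧ G.≈ ⟦ t ⟧)
            → ∀ {s t} → s ~ t → ⟦ s ⟧ G.≈ ⟦ t ⟧
    ⟦⟧-cong R-sound (rel p)                = R-sound p
    ⟦⟧-cong R-sound refl                   = G.refl
    ⟦⟧-cong R-sound (sym p)                = G.sym (⟦⟧-cong R-sound p)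
    ⟦⟧-cong R-sound (trans p q)            = G.trans (⟦⟧-cong R-sound p) (⟦⟧-cong R-sound q)
    ⟦⟧-cong R-sound (∙-cong p q)           = G.∙-cong (⟦⟧-cong R-sound p) (⟦⟧-cong R-sound q)
    ⟦⟧-cong R-sound (⁻¹-cong p)            = G.⁻¹-cong (⟦⟧-cong R-sound p)
    ⟦⟧-cong R-sound (assoc {s} {t} {u})    = G.assoc ⟦ s ⟧ ⟦ t ⟧ ⟦ u ⟧
    ⟦⟧-cong R-sound (identityˡ {s})        = G.identityˡ ⟦ s ⟧
    ⟦⟧-cong R-sound (identityʳ {s})        = G.identityʳ ⟦ s ⟧
    ⟦⟧-cong R-sound (inverseˡ {s})         = G.inverseˡ ⟦ s ⟧
    ⟦⟧-cong R-sound (inverseʳ {s})         = G.inverseʳ ⟦ s ⟧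
    ⟦⟧-cong R-sound (comm {s} {t})         = G.comm ⟦ s ⟧ ⟦ t ⟧

module FreimanPushout {ℓ} (k : ℕ) {C A B : NAddSet ℓ} (f : Hom k C A) (g : Hom k C B) where
  private
    module A′ = NAddSet A
    module B′ = NAddSet B

  Gen : Set ℓ
  Gen = A′.El ⊎ B′.El

  data Relator : Rel (Term Gen) ℓ where
    ≈-A       : ∀ {a a′} → proj₁ a A′.≈ proj₁ a′ → Relator (var (inj₁ a)) (var (inj₁ a′))
    ≈-B       : ∀ {b b′} → proj₁ b B′.≈ proj₁ b′ → Relator (var (inj₂ b)) (var (inj₂ b′))
    zero-A    : Relator (var (inj₁ A′.zeroEl)) ε
    zero-B    : Relator (var (inj₂ B′.zeroEl)) ε
    glue      : (c : NAddSet.El C) → Relator (var (inj₁ (fun f c))) (var (inj₂ (fun g c)))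
    freiman-A : (as bs : Vec A′.El k) → A′.sumV as A′.≈ A′.sumV bs
              → Relator (sumVars (map inj₁ as)) (sumVars (map inj₁ bs))
    freiman-B : (as bs : Vec B′.El k) → B′.sumV as B′.≈ B′.sumV bs
              → Relator (sumVars (map inj₂ as)) (sumVars (map inj₂ bs))

  open Presentation Relator

  generators : List (Term Gen)
  generators = mapᴸ var (mapᴸ inj₁ (elemsEl A) ++ mapᴸ inj₂ (elemsEl B))

  infix 4 _∈generators
  _∈generators : Term Gen → Set ℓ
  s ∈generators = Any (s ~_) generators

  inj₁∈generators : (a : A′.El) → var (inj₁ a) ∈generators
  inj₁∈generators a = map⁺ (++⁺ˡ (map⁺ (Any.map (rel ∘ ≈-A) (El∈elemsEl A a))))

  inj₂∈generators : (b : B′.El) → var (inj₂ b) ∈generators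
  inj₂∈generators b = map⁺ (++⁺ʳ _ (map⁺ (Any.map (rel ∘ ≈-B) (El∈elemsEl B b))))

  P : NAddSet ℓ
  P = record
    { grp   = presented
    ; elems = generators
    ; zero∈ = Any.map (trans (sym (rel zero-A))) (inj₁∈generators A′.zeroEl)
    }

  private module P′ = NAddSet P

  generatorOf : (u : P′.El) → Σ Gen (λ s → proj₁ u ~ var s)
  generatorOf (_ , u∈) = satisfied (map⁻ u∈)

  sumV-generators : ∀ {n} {Y : Set ℓ} (ι : Y → Gen) (ι∈ : ∀ y → var (ι y) ∈generators)
                  → (ys : Vec Y n)
                  → P′.sumV (map (λ y → var (ι y) , ι∈ y) ys) ≡.≡ sumVars (map ι ys)
  sumV-generators ι ι∈ []       = ≡.refl
  sumV-generators ι ι∈ (y ∷ ys) = ≡.cong (var (ι y) ∙_) (sumV-generators ι ι∈ ys)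

  generatorHom : {D : NAddSet ℓ} (ι : NAddSet.El D → Gen) (ι∈ : ∀ a → var (ι a) ∈generators)
               → (∀ {a a′} → NAddSet._≈_ D (proj₁ a) (proj₁ a′) → var (ι a) ~ var (ι a′))
               → var (ι (NAddSet.zeroEl D)) ~ ε
               → (∀ as bs → NAddSet._≈_ D (NAddSet.sumV D as) (NAddSet.sumV D bs)
                          → sumVars (map ι as) ~ sumVars (map ι bs))
               → Hom k D P
  generatorHom ι ι∈ ι-resp ι-zero ι-freiman = record
    { fun     = λ a → var (ι a) , ι∈ a
    ; resp    = ι-resp
    ; pres0   = ι-zero
    ; freiman = λ as bs e → ≡.subst₂ _~_ (≡.sym (sumV-generators ι ι∈ as))
                                         (≡.sym (sumV-generators ι ι∈ bs)) (ι-freiman as bs e)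
    }

  i : Hom k A P
  i = generatorHom inj₁ inj₁∈generators (rel ∘ ≈-A) (rel zero-A) (λ as bs → rel ∘ freiman-A as bs)

  j : Hom k B P
  j = generatorHom inj₂ inj₂∈generators (rel ∘ ≈-B) (rel zero-B) (λ as bs → rel ∘ freiman-B as bs)

  commutes : (i ∘H f) ≈H (j ∘H g)
  commutes = rel ∘ glue

  jointlyEpic : {Q : NAddSet ℓ} (h h′ : Hom k P Q)
              → (h ∘H i) ≈H (h′ ∘H i) → (h ∘H j) ≈H (h′ ∘H j) → h ≈H h′
  jointlyEpic {Q} h h′ h∘i≈h′∘i h∘j≈h′∘j u = agreeOn (generatorOf u)
    where
    module Q = NAddSet Q
    agreeOn : Σ Gen (λ s → proj₁ u ~ var s) → proj₁ (fun h u) Q.≈ proj₁ (fun h′ u)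
    agreeOn (inj₁ a , u~a) = Q.trans (resp h u~a) (Q.trans (h∘i≈h′∘i a) (Q.sym (resp h′ u~a)))
    agreeOn (inj₂ b , u~b) = Q.trans (resp h u~b) (Q.trans (h∘j≈h′∘j b) (Q.sym (resp h′ u~b)))

  module Mediator (Q : NAddSet ℓ) (i′ : Hom k A Q) (j′ : Hom k B Q)
                  (cocone : (i′ ∘H f) ≈H (j′ ∘H g)) where
    private module Q = NAddSet Q

    copair : Gen → Q.El
    copair = [ fun i′ , fun j′ ]

    open Eval Q.grp (proj₁ ∘ copair)

    ⟦sumVars⟧ : ∀ {n} {Y : Set ℓ} (ι : Y → Gen) (ys : Vec Y n)
              → ⟦ sumVars (map ι ys) ⟧ ≡.≡ Q.sumV (map (copair ∘ ι) ys)
    ⟦sumVars⟧ ι []       = ≡.refl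
    ⟦sumVars⟧ ι (y ∷ ys) = ≡.cong (proj₁ (copair (ι y)) Q.∙_) (⟦sumVars⟧ ι ys)

    relator-sound : ∀ {s t} → Relator s t → ⟦ s ⟧ Q.≈ ⟦ t ⟧
    relator-sound (≈-A p)              = resp i′ p
    relator-sound (≈-B p)              = resp j′ p
    relator-sound zero-A               = pres0 i′
    relator-sound zero-B               = pres0 j′
    relator-sound (glue c)             = cocone c
    relator-sound (freiman-A as bs e)  =
      ≡.subst₂ Q._≈_ (≡.sym (⟦sumVars⟧ inj₁ as)) (≡.sym (⟦sumVars⟧ inj₁ bs)) (freiman i′ as bs e)
    relator-sound (freiman-B as bs e)  =
      ≡.subst₂ Q._≈_ (≡.sym (⟦sumVars⟧ inj₂ as)) (≡.sym (⟦sumVars⟧ inj₂ bs)) (freiman j′ as bs e)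

    restriction : (φ : P′.El → Q.El) → (∀ u → proj₁ (φ u) Q.≈ ⟦ proj₁ u ⟧) → Hom k P Q
    restriction φ φ≈⟦⟧ = record
      { fun     = φ
      ; resp    = λ {u} {u′} u~u′ →
                    Q.trans (φ≈⟦⟧ u) (Q.trans (⟦⟧-cong relator-sound u~u′) (Q.sym (φ≈⟦⟧ u′)))
      ; pres0   = φ≈⟦⟧ P′.zeroEl
      ; freiman = λ as bs e →
                    Q.trans (sumV-φ as) (Q.trans (⟦⟧-cong relator-sound e) (Q.sym (sumV-φ bs)))
      }
      where
      sumV-φ : ∀ {n} (us : Vec P′.El n) → Q.sumV (map φ us) Q.≈ ⟦ P′.sumV us ⟧
      sumV-φ []       = Q.refl
      sumV-φ (u ∷ us) = Q.∙-cong (φ≈⟦⟧ u) (sumV-φ us)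

    copair-generatorOf≈⟦⟧ : ∀ u → proj₁ (copair (proj₁ (generatorOf u))) Q.≈ ⟦ proj₁ u ⟧
    copair-generatorOf≈⟦⟧ u = Q.sym (⟦⟧-cong relator-sound (proj₂ (generatorOf u)))

    mediator : Hom k P Q
    mediator = restriction (copair ∘ proj₁ ∘ generatorOf) copair-generatorOf≈⟦⟧

    mediator∘i≈i′ : (mediator ∘H i) ≈H i′
    mediator∘i≈i′ a = copair-generatorOf≈⟦⟧ (fun i a)

    mediator∘j≈j′ : (mediator ∘H j) ≈H j′
    mediator∘j≈j′ b = copair-generatorOf≈⟦⟧ (fun j b)

    mediator-unique : (h : Hom k P Q) → (h ∘H i) ≈H i′ → (h ∘H j) ≈H j′ → h ≈H mediator
    mediator-unique h h∘i≈i′ h∘j≈j′ = jointlyEpic h mediator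
      (λ a → Q.trans (h∘i≈i′ a) (Q.sym (mediator∘i≈i′ a)))
      (λ b → Q.trans (h∘j≈j′ b) (Q.sym (mediator∘j≈j′ b)))

  isPushout : IsPushout f g i j
  isPushout = record
    { commutes  = commutes
    ; universal = λ Q i′ j′ cocone → let open Mediator Q i′ j′ cocone in
                  mediator , mediator∘i≈i′ , mediator∘j≈j′ , mediator-unique
    }

mainTheorem5 : ∀ {ℓ : Level} (k : ℕ) → k ≥ 1 → HasPushouts ℓ k
mainTheorem5 k _ f g = P , i , j , isPushout
  where open FreimanPushout k f g
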